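{- Let $P$ be a finite poset and $m\ge1$. The map $\tau\mapsto(\pi,\, i_*(\tau)-1,\, p_*(\tau))$, where $\pi(p)=\min\tau(p)$ for all $p\in P$, is a bijection from $\mathcal{RPP}^{+1}_m(P)$ to the set of triples $(\pi,i,p)$ with $\pi\in\mathcal{RPP}_m(P)$, $i\in\{0,1,\dots,m-1\}$, and $p$ a maximal element of the order ideal $\pi^{ -1}(\{0,1,\dots,i\})$.
   Context: A reverse $P$-partition is an order-preserving map $\pi:P\to\mathbb{N}$; $\mathcal{RPP}_m(P)$ is the set of those with values in $\{0,\dots,m\}$. A barely set-valued reverse $P$-partition with values in $\{0,\dots,m\}$ is a map $\tau$ from $P$ to nonempty subsets of $\{0,\dots,m\}$ with $\max\tau(p)\le\min\tau(p')$ whenever $p<p'$, such that exactly one element $p_*(\tau)$ has $\#\tau(p_*(\tau))=2$ and all other elements have singletons; $\mathcal{RPP}^{+1}_m(P)$ is their set, and $i_*(\tau)=\max\tau(p_*(\tau))$. -}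

module Defs where

open import Data.Nat using (ℕ; zero; suc; _≤_; _∸_)
open import Data.Fin using (Fin; toℕ; zero; suc)
open import Data.Fin.Subset using (Subset; _∈_; ∣_∣; inside; outside)
open import Data.Vec using (Vec; []; _∷_; lookup)
open import Data.Maybe using (Maybe; just; nothing; fromMaybe)
import Data.Maybe as Maybe
open import Data.Product using (_×_)
open import Relation.Binary.PropositionalEquality using (_≡_; _≢_)
open import Relation.Binary.Core using (Rel)
open import Relation.Binary.Structures using (IsPartialOrder)
open import Relation.Nullary using (¬_)

record FinPoset : Set₁ where
  field
    n         : ℕ
    _≼_       : Rel (Fin n) _
    isPartialOrder : IsPartialOrder _≡_ _≼_

  _≺_ : Rel (Fin n) _
  p ≺ q = (p ≼ q) × (p ≢ q)

minElem : ∀ {k} → Subset k → Maybe (Fin k)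
minElem []            = nothing
minElem (inside ∷ s)  = just zero
minElem (outside ∷ s) = Maybe.map suc (minElem s)

maxElem : ∀ {k} → Subset k → Maybe (Fin k)
maxElem []           = nothing
maxElem (b ∷ s) with maxElem s
... | just j  = just (suc j)
... | nothing with b
...   | inside  = just zero
...   | outside = nothing

-- min / max of a (nonempty) subset of {0,…,m}; default 0 is never used
-- on the nonempty sets occurring below.
minSub : ∀ {m} → Subset (suc m) → Fin (suc m)
minSub s = fromMaybe zero (minElem s)

maxSub : ∀ {m} → Subset (suc m) → Fin (suc m)
maxSub s = fromMaybe zero (maxElem s)

module _ (P : FinPoset) (m : ℕ) where
  open FinPoset P

  IsRPP : Vec (Fin (suc m)) n → Set
  IsRPP π = ∀ p q → p ≼ q → toℕ (lookup π p) ≤ toℕ (lookup π q)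

  -- RPP_m(P); proof field irrelevant, so equality = equality of π
  record RPP : Set where
    constructor mkRPP
    field
      π      : Vec (Fin (suc m)) n
      .isRPP : IsRPP π

  -- The field p* records
  -- the (necessarily unique) element with #τ(p*) = 2; it is determined by τ.
  record RPP+1 : Set where
    constructor mkRPP+1
    field
      τ        : Vec (Subset (suc m)) n
      p*       : Fin n
      .two     : ∣ lookup τ p* ∣ ≡ 2
      .ones    : ∀ q → q ≢ p* → ∣ lookup τ q ∣ ≡ 1
      .ordered : ∀ p q → p ≺ q → ∀ a b → a ∈ lookup τ p → b ∈ lookup τ q
                 → toℕ a ≤ toℕ b

    i* : Fin (suc m)
    i* = maxSub (lookup τ p*)

  InIdeal : Vec (Fin (suc m)) n → ℕ → Fin n → Set
  InIdeal π i q = toℕ (lookup π q) ≤ i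

  IsMaximalIn : Vec (Fin (suc m)) n → ℕ → Fin n → Set
  IsMaximalIn π i p = InIdeal π i p × (∀ q → InIdeal π i q → p ≼ q → q ≡ p)

  record Triple : Set where
    constructor mkTriple
    field
      π      : Vec (Fin (suc m)) n
      .isRPP : IsRPP π
      i      : Fin m
      p      : Fin n
      .maxl  : IsMaximalIn π (toℕ i) p

-- A barely set-valued partition τ is recovered from π = min ∘ τ, its doubled element p*
-- and the top value i* of τ(p*): every other fibre is the singleton {π(q)}, and
-- τ(p*) = {π(p*), i*}.  Conversely, adjoining i + 1 to the fibre of p gives a barely
-- set-valued partition exactly when π(p) < i + 1 ≤ π(q) for every q > p, i.e. when p is a
-- maximal element of the order ideal π⁻¹{0,…,i}.
module Submission where

open import Defs
open import Data.Bool using (if_then_else_)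
import Data.Nat as ℕ
open import Data.Nat using (ℕ; zero; suc; _≤_; _∸_; z≤n; s≤s; s≤s⁻¹; _≤?_)
open import Data.Nat.Properties
  using (suc-injective; ≤-refl; ≤-trans; n≤1+n; ≰⇒>; 1+n≰n; m<n⇒0<n; module ≤-Reasoning)
open import Data.Fin using (Fin; toℕ; zero; suc; _<_; _≟_; reduce≥)
open import Data.Fin.Subset using (Subset; _∈_; ∣_∣; inside; outside; ⊥; ⁅_⁆; _∪_)
open import Data.Fin.Subset.Properties
  using (∣⁅x⁆∣≡1; x∈⁅x⁆; x∈⁅y⁆⇒x≡y; x∈p∪q⁺; x∈p∪q⁻; ∪-identityˡ)
open import Data.Vec using (Vec; []; _∷_; lookup; tabulate)
open import Data.Vec.Properties using (lookup∘tabulate; tabulate∘lookup; tabulate-cong)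
open import Data.Maybe using (just; nothing)
import Data.Maybe as Maybe
open import Data.Product using (Σ; _×_; _,_; proj₁; ∃; ∃₂)
open import Data.Sum using (_⊎_; inj₁; inj₂)
open import Data.Empty using (⊥-elim)
open import Function.Base using (_∘_)
open import Function.Definitions using (Bijective)
open import Function.Consequences.Propositional
  using (inverseᵇ⇒bijective; strictlyInverseˡ⇒inverseˡ; strictlyInverseʳ⇒inverseʳ)
open import Relation.Binary.PropositionalEquality
open import Relation.Nullary using (yes; no; does)
open import Relation.Nullary.Decidable using (recompute; dec-true; dec-false)

private
  variable
    k : ℕ

∣p∣≡0⇒p≡⊥ : (p : Subset k) → ∣ p ∣ ≡ 0 → p ≡ ⊥
∣p∣≡0⇒p≡⊥ []            _   = refl
∣p∣≡0⇒p≡⊥ (inside  ∷ p) ()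
∣p∣≡0⇒p≡⊥ (outside ∷ p) ∣p∣≡0 = cong (outside ∷_) (∣p∣≡0⇒p≡⊥ p ∣p∣≡0)

∣p∣≡1⇒p≡⁅x⁆ : (p : Subset k) → ∣ p ∣ ≡ 1 → ∃ λ x → p ≡ ⁅ x ⁆
∣p∣≡1⇒p≡⁅x⁆ (inside  ∷ p) ∣p∣≡1 = zero , cong (inside ∷_) (∣p∣≡0⇒p≡⊥ p (suc-injective ∣p∣≡1))
∣p∣≡1⇒p≡⁅x⁆ (outside ∷ p) ∣p∣≡1 with ∣p∣≡1⇒p≡⁅x⁆ p ∣p∣≡1
... | x , refl = suc x , refl

∣p∣≡2⇒p≡⁅x⁆∪⁅y⁆ : (p : Subset k) → ∣ p ∣ ≡ 2 → ∃₂ λ x y → x < y × p ≡ ⁅ x ⁆ ∪ ⁅ y ⁆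
∣p∣≡2⇒p≡⁅x⁆∪⁅y⁆ (inside  ∷ p) ∣p∣≡2 with ∣p∣≡1⇒p≡⁅x⁆ p (suc-injective ∣p∣≡2)
... | y , refl = zero , suc y , s≤s z≤n , cong (inside ∷_) (sym (∪-identityˡ ⁅ y ⁆))
∣p∣≡2⇒p≡⁅x⁆∪⁅y⁆ (outside ∷ p) ∣p∣≡2 with ∣p∣≡2⇒p≡⁅x⁆∪⁅y⁆ p ∣p∣≡2
... | x , y , x<y , refl = suc x , suc y , s≤s x<y , refl

∣⁅x⁆∪⁅y⁆∣≡2 : (x y : Fin k) → x < y → ∣ ⁅ x ⁆ ∪ ⁅ y ⁆ ∣ ≡ 2
∣⁅x⁆∪⁅y⁆∣≡2 zero    (suc y) _         rewrite ∪-identityˡ ⁅ y ⁆ = cong suc (∣⁅x⁆∣≡1 y)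
∣⁅x⁆∪⁅y⁆∣≡2 (suc x) (suc y) (s≤s x<y) = ∣⁅x⁆∪⁅y⁆∣≡2 x y x<y

minElem-⁅x⁆ : (x : Fin k) → minElem ⁅ x ⁆ ≡ just x
minElem-⁅x⁆ zero    = refl
minElem-⁅x⁆ (suc x) = cong (Maybe.map suc) (minElem-⁅x⁆ x)

maxElem-⊥ : maxElem (⊥ {k}) ≡ nothing
maxElem-⊥ {zero}  = refl
maxElem-⊥ {suc k} rewrite maxElem-⊥ {k} = refl

maxElem-⁅x⁆ : (x : Fin k) → maxElem ⁅ x ⁆ ≡ just x
maxElem-⁅x⁆ {suc k} zero rewrite maxElem-⊥ {k} = refl
maxElem-⁅x⁆ (suc x)      rewrite maxElem-⁅x⁆ x = refl

minElem-⁅x⁆∪⁅y⁆ : (x y : Fin k) → x < y → minElem (⁅ x ⁆ ∪ ⁅ y ⁆) ≡ just x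
minElem-⁅x⁆∪⁅y⁆ zero    (suc y) _         = refl
minElem-⁅x⁆∪⁅y⁆ (suc x) (suc y) (s≤s x<y) = cong (Maybe.map suc) (minElem-⁅x⁆∪⁅y⁆ x y x<y)

maxElem-⁅x⁆∪⁅y⁆ : (x y : Fin k) → x < y → maxElem (⁅ x ⁆ ∪ ⁅ y ⁆) ≡ just y
maxElem-⁅x⁆∪⁅y⁆ zero    (suc y) _         rewrite ∪-identityˡ ⁅ y ⁆ | maxElem-⁅x⁆ y = refl
maxElem-⁅x⁆∪⁅y⁆ (suc x) (suc y) (s≤s x<y) rewrite maxElem-⁅x⁆∪⁅y⁆ x y x<y = refl

minSub-⁅x⁆ : (x : Fin (suc k)) → minSub ⁅ x ⁆ ≡ x
minSub-⁅x⁆ x rewrite minElem-⁅x⁆ x = refl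

minSub-⁅x⁆∪⁅y⁆ : (x y : Fin (suc k)) → x < y → minSub (⁅ x ⁆ ∪ ⁅ y ⁆) ≡ x
minSub-⁅x⁆∪⁅y⁆ x y x<y rewrite minElem-⁅x⁆∪⁅y⁆ x y x<y = refl

maxSub-⁅x⁆∪⁅y⁆ : (x y : Fin (suc k)) → x < y → maxSub (⁅ x ⁆ ∪ ⁅ y ⁆) ≡ y
maxSub-⁅x⁆∪⁅y⁆ x y x<y rewrite maxElem-⁅x⁆∪⁅y⁆ x y x<y = refl

module _ (p : Subset (suc k)) where

  ∣p∣≡1⇒p≡⁅minSub⁆ : ∣ p ∣ ≡ 1 → p ≡ ⁅ minSub p ⁆
  ∣p∣≡1⇒p≡⁅minSub⁆ ∣p∣≡1 with ∣p∣≡1⇒p≡⁅x⁆ p ∣p∣≡1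
  ... | x , refl = cong ⁅_⁆ (sym (minSub-⁅x⁆ x))

  ∣p∣≡2⇒minSub<maxSub : ∣ p ∣ ≡ 2 → minSub p < maxSub p
  ∣p∣≡2⇒minSub<maxSub ∣p∣≡2 with ∣p∣≡2⇒p≡⁅x⁆∪⁅y⁆ p ∣p∣≡2
  ... | x , y , x<y , refl
    rewrite minSub-⁅x⁆∪⁅y⁆ x y x<y | maxSub-⁅x⁆∪⁅y⁆ x y x<y = x<y

  ∣p∣≡2⇒1≤maxSub : ∣ p ∣ ≡ 2 → 1 ≤ toℕ (maxSub p)
  ∣p∣≡2⇒1≤maxSub ∣p∣≡2 = m<n⇒0<n (∣p∣≡2⇒minSub<maxSub ∣p∣≡2)

  ∣p∣≡2⇒p≡⁅minSub⁆∪⁅maxSub⁆ : ∣ p ∣ ≡ 2 → p ≡ ⁅ minSub p ⁆ ∪ ⁅ maxSub p ⁆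
  ∣p∣≡2⇒p≡⁅minSub⁆∪⁅maxSub⁆ ∣p∣≡2 with ∣p∣≡2⇒p≡⁅x⁆∪⁅y⁆ p ∣p∣≡2
  ... | x , y , x<y , refl
    rewrite minSub-⁅x⁆∪⁅y⁆ x y x<y | maxSub-⁅x⁆∪⁅y⁆ x y x<y = refl

  ∣p∣≡1⇒minSub∈p : ∣ p ∣ ≡ 1 → minSub p ∈ p
  ∣p∣≡1⇒minSub∈p ∣p∣≡1 = subst (minSub p ∈_) (sym (∣p∣≡1⇒p≡⁅minSub⁆ ∣p∣≡1)) (x∈⁅x⁆ _)

  ∣p∣≡2⇒minSub∈p : ∣ p ∣ ≡ 2 → minSub p ∈ p
  ∣p∣≡2⇒minSub∈p ∣p∣≡2 =
    subst (minSub p ∈_) (sym (∣p∣≡2⇒p≡⁅minSub⁆∪⁅maxSub⁆ ∣p∣≡2)) (x∈p∪q⁺ (inj₁ (x∈⁅x⁆ _)))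

  ∣p∣≡2⇒maxSub∈p : ∣ p ∣ ≡ 2 → maxSub p ∈ p
  ∣p∣≡2⇒maxSub∈p ∣p∣≡2 =
    subst (maxSub p ∈_) (sym (∣p∣≡2⇒p≡⁅minSub⁆∪⁅maxSub⁆ ∣p∣≡2)) (x∈p∪q⁺ (inj₂ (x∈⁅x⁆ _)))

lookup-ext : {A : Set} {xs ys : Vec A k} → (∀ i → lookup xs i ≡ lookup ys i) → xs ≡ ys
lookup-ext {xs = xs} {ys} lookup≡ = begin
  xs                 ≡⟨ tabulate∘lookup xs ⟨
  tabulate (lookup xs) ≡⟨ tabulate-cong lookup≡ ⟩
  tabulate (lookup ys) ≡⟨ tabulate∘lookup ys ⟩
  ys                 ∎
  where open ≡-Reasoning

toℕ-reduce≥ : (i : Fin (suc k)) .(1≤i : 1 ≤ toℕ i) → toℕ (reduce≥ i 1≤i) ≡ toℕ i ∸ 1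
toℕ-reduce≥ (suc i) _ = refl

suc-reduce≥ : (i : Fin (suc k)) .(1≤i : 1 ≤ toℕ i) → suc (reduce≥ i 1≤i) ≡ i
suc-reduce≥ (suc i) _ = refl

reduce≥-≡suc : ∀ {j : Fin (suc k)} {i} → j ≡ suc i → .{1≤j : 1 ≤ toℕ j} → reduce≥ j 1≤j ≡ i
reduce≥-≡suc refl = refl

module Correspondence (P : FinPoset) (m : ℕ) where
  open FinPoset P

  Ordered : Vec (Subset (suc m)) n → Set
  Ordered τ = ∀ p q → p ≺ q → ∀ a b → a ∈ lookup τ p → b ∈ lookup τ q → toℕ a ≤ toℕ b

  minima : Vec (Subset (suc m)) n → Vec (Fin (suc m)) n
  minima τ = tabulate λ q → minSub (lookup τ q)

  lookup-minima : (τ : Vec (Subset (suc m)) n) (q : Fin n) →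
                  lookup (minima τ) q ≡ minSub (lookup τ q)
  lookup-minima τ = lookup∘tabulate _

  adjoinAt : Vec (Fin (suc m)) n → Fin m → Fin n → Vec (Subset (suc m)) n
  adjoinAt π i p = tabulate λ q →
    if does (q ≟ p) then ⁅ lookup π q ⁆ ∪ ⁅ suc i ⁆ else ⁅ lookup π q ⁆

  module _ (π : Vec (Fin (suc m)) n) (i : Fin m) (p : Fin n) where

    lookup-adjoinAt-≡ : lookup (adjoinAt π i p) p ≡ ⁅ lookup π p ⁆ ∪ ⁅ suc i ⁆
    lookup-adjoinAt-≡ = trans (lookup∘tabulate _ p)
      (cong (λ b → if b then ⁅ lookup π p ⁆ ∪ ⁅ suc i ⁆ else ⁅ lookup π p ⁆)
            (dec-true (p ≟ p) refl))

    lookup-adjoinAt-≢ : ∀ {q} → q ≢ p → lookup (adjoinAt π i p) q ≡ ⁅ lookup π q ⁆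
    lookup-adjoinAt-≢ {q} q≢p = trans (lookup∘tabulate _ q)
      (cong (λ b → if b then ⁅ lookup π q ⁆ ∪ ⁅ suc i ⁆ else ⁅ lookup π q ⁆)
            (dec-false (q ≟ p) q≢p))

    ∈-adjoinAt : ∀ {a} q → a ∈ lookup (adjoinAt π i p) q → a ≡ lookup π q ⊎ (q ≡ p × a ≡ suc i)
    ∈-adjoinAt {a} q a∈ with q ≟ p
    ... | no q≢p = inj₁ (x∈⁅y⁆⇒x≡y _ (subst (a ∈_) (lookup-adjoinAt-≢ q≢p) a∈))
    ... | yes refl with x∈p∪q⁻ _ _ (subst (a ∈_) lookup-adjoinAt-≡ a∈)
    ...   | inj₁ a∈⁅πq⁆  = inj₁ (x∈⁅y⁆⇒x≡y _ a∈⁅πq⁆)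
    ...   | inj₂ a∈⁅1+i⁆ = inj₂ (refl , x∈⁅y⁆⇒x≡y _ a∈⁅1+i⁆)

    ∣adjoinAt-≢∣≡1 : ∀ q → q ≢ p → ∣ lookup (adjoinAt π i p) q ∣ ≡ 1
    ∣adjoinAt-≢∣≡1 q q≢p rewrite lookup-adjoinAt-≢ q≢p = ∣⁅x⁆∣≡1 (lookup π q)

    module _ (πp≤i : toℕ (lookup π p) ≤ toℕ i) where

      ∣adjoinAt-≡∣≡2 : ∣ lookup (adjoinAt π i p) p ∣ ≡ 2
      ∣adjoinAt-≡∣≡2 rewrite lookup-adjoinAt-≡ = ∣⁅x⁆∪⁅y⁆∣≡2 _ _ (s≤s πp≤i)

      maxSub-adjoinAt : maxSub (lookup (adjoinAt π i p) p) ≡ suc i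
      maxSub-adjoinAt rewrite lookup-adjoinAt-≡ = maxSub-⁅x⁆∪⁅y⁆ _ _ (s≤s πp≤i)

      minima-adjoinAt : minima (adjoinAt π i p) ≡ π
      minima-adjoinAt = lookup-ext λ q →
        trans (lookup-minima (adjoinAt π i p) q) (minSub-adjoinAt q)
        where
        minSub-adjoinAt : ∀ q → minSub (lookup (adjoinAt π i p) q) ≡ lookup π q
        minSub-adjoinAt q with q ≟ p
        ... | yes refl rewrite lookup-adjoinAt-≡ = minSub-⁅x⁆∪⁅y⁆ _ _ (s≤s πp≤i)
        ... | no q≢p   rewrite lookup-adjoinAt-≢ q≢p = minSub-⁅x⁆ _

    adjoinAt-ordered : IsRPP P m π → IsMaximalIn P m π (toℕ i) p → Ordered (adjoinAt π i p)
    adjoinAt-ordered π-rpp (πp≤i , p-maximal) p₁ p₂ (p₁≼p₂ , p₁≢p₂) a b a∈ b∈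
      with ∈-adjoinAt p₁ a∈ | ∈-adjoinAt p₂ b∈
    ... | inj₁ refl          | inj₁ refl          = π-rpp p₁ p₂ p₁≼p₂
    ... | inj₁ refl          | inj₂ (refl , refl) = ≤-trans (π-rpp p₁ p₂ p₁≼p₂) (≤-trans πp≤i (n≤1+n _))
    ... | inj₂ (refl , _)    | inj₂ (refl , _)    = ⊥-elim (p₁≢p₂ refl)
    ... | inj₂ (refl , refl) | inj₁ refl with toℕ (lookup π p₂) ≤? toℕ i
    ...   | yes πp₂≤i = ⊥-elim (p₁≢p₂ (sym (p-maximal p₂ πp₂≤i p₁≼p₂)))
    ...   | no  πp₂≰i = ≰⇒> πp₂≰i

  module _ (τ : Vec (Subset (suc m)) n) (p* : Fin n)
           (two : ∣ lookup τ p* ∣ ≡ 2) (ones : ∀ q → q ≢ p* → ∣ lookup τ q ∣ ≡ 1) where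

    private
      i* : Fin (suc m)
      i* = maxSub (lookup τ p*)

    minSub∈ : ∀ q → minSub (lookup τ q) ∈ lookup τ q
    minSub∈ q with q ≟ p*
    ... | yes refl = ∣p∣≡2⇒minSub∈p _ two
    ... | no q≢p*  = ∣p∣≡1⇒minSub∈p _ (ones q q≢p*)

    adjoinAt-minima : .(1≤i* : 1 ≤ toℕ i*) → adjoinAt (minima τ) (reduce≥ i* 1≤i*) p* ≡ τ
    adjoinAt-minima 1≤i* = lookup-ext fibre≡
      where
      open ≡-Reasoning

      i : Fin m
      i = reduce≥ i* 1≤i*

      fibre≡ : ∀ q → lookup (adjoinAt (minima τ) i p*) q ≡ lookup τ q
      fibre≡ q with q ≟ p*
      ... | yes refl = begin
        lookup (adjoinAt (minima τ) i q) q   ≡⟨ lookup-adjoinAt-≡ (minima τ) i q ⟩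
        ⁅ lookup (minima τ) q ⁆ ∪ ⁅ suc i ⁆  ≡⟨ cong₂ (λ x y → ⁅ x ⁆ ∪ ⁅ y ⁆)
                                                  (lookup-minima τ q) (suc-reduce≥ i* 1≤i*) ⟩
        ⁅ minSub (lookup τ q) ⁆ ∪ ⁅ i* ⁆     ≡⟨ ∣p∣≡2⇒p≡⁅minSub⁆∪⁅maxSub⁆ _ two ⟨
        lookup τ q                           ∎
      ... | no q≢p* = begin
        lookup (adjoinAt (minima τ) i p*) q  ≡⟨ lookup-adjoinAt-≢ (minima τ) i p* q≢p* ⟩
        ⁅ lookup (minima τ) q ⁆              ≡⟨ cong ⁅_⁆ (lookup-minima τ q) ⟩
        ⁅ minSub (lookup τ q) ⁆              ≡⟨ ∣p∣≡1⇒p≡⁅minSub⁆ _ (ones q q≢p*) ⟨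
        lookup τ q                           ∎

    module _ (ordered : Ordered τ) where

      minima-isRPP : IsRPP P m (minima τ)
      minima-isRPP p q p≼q with p ≟ q
      ... | yes refl = ≤-refl
      ... | no p≢q rewrite lookup-minima τ p | lookup-minima τ q =
        ordered p q (p≼q , p≢q) _ _ (minSub∈ p) (minSub∈ q)

      minima-isMaximal : .(1≤i* : 1 ≤ toℕ i*) →
                         IsMaximalIn P m (minima τ) (toℕ (reduce≥ i* 1≤i*)) p*
      minima-isMaximal 1≤i* = πp*≤i , p*-maximal
        where
        open ≤-Reasoning

        1+i≡i* : suc (toℕ (reduce≥ i* 1≤i*)) ≡ toℕ i*
        1+i≡i* = cong toℕ (suc-reduce≥ i* 1≤i*)

        πp*≤i : toℕ (lookup (minima τ) p*) ≤ toℕ (reduce≥ i* 1≤i*)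
        πp*≤i = s≤s⁻¹ (begin
          suc (toℕ (lookup (minima τ) p*)) ≡⟨ cong (suc ∘ toℕ) (lookup-minima τ p*) ⟩
          suc (toℕ (minSub (lookup τ p*))) ≤⟨ ∣p∣≡2⇒minSub<maxSub (lookup τ p*) two ⟩
          toℕ i*                           ≡⟨ 1+i≡i* ⟨
          suc (toℕ (reduce≥ i* 1≤i*))      ∎)

        p*-maximal : ∀ q → toℕ (lookup (minima τ) q) ≤ toℕ (reduce≥ i* 1≤i*) → p* ≼ q → q ≡ p*
        p*-maximal q πq≤i p*≼q with q ≟ p*
        ... | yes q≡p* = q≡p*
        ... | no q≢p*  = ⊥-elim (1+n≰n (begin
          suc (toℕ (reduce≥ i* 1≤i*))  ≡⟨ 1+i≡i* ⟩
          toℕ i*                       ≤⟨ ordered p* q (p*≼q , q≢p* ∘ sym) _ _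
                                            (∣p∣≡2⇒maxSub∈p _ two) (minSub∈ q) ⟩
          toℕ (minSub (lookup τ q))    ≡⟨ cong toℕ (lookup-minima τ q) ⟨
          toℕ (lookup (minima τ) q)    ≤⟨ πq≤i ⟩
          toℕ (reduce≥ i* 1≤i*)        ∎))

  toTriple : RPP+1 P m → Triple P m
  toTriple (mkRPP+1 τ p* two ones ordered) =
    mkTriple (minima τ) (minima-isRPP τ p* two ones ordered)
             (reduce≥ i* (∣p∣≡2⇒1≤maxSub (lookup τ p*) two))
             p* (minima-isMaximal τ p* two ones ordered _)
    where
    i* : Fin (suc m)
    i* = maxSub (lookup τ p*)

  fromTriple : Triple P m → RPP+1 P m
  fromTriple (mkTriple π π-rpp i p p-maximal) =
    mkRPP+1 (adjoinAt π i p) p (∣adjoinAt-≡∣≡2 π i p (proj₁ p-maximal))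
            (∣adjoinAt-≢∣≡1 π i p) (adjoinAt-ordered π i p π-rpp p-maximal)

  RPP+1-≡ : {t₁ t₂ : RPP+1 P m} → RPP+1.τ t₁ ≡ RPP+1.τ t₂ → RPP+1.p* t₁ ≡ RPP+1.p* t₂ → t₁ ≡ t₂
  RPP+1-≡ refl refl = refl

  Triple-≡ : {T₁ T₂ : Triple P m} → Triple.π T₁ ≡ Triple.π T₂ →
             Triple.i T₁ ≡ Triple.i T₂ → Triple.p T₁ ≡ Triple.p T₂ → T₁ ≡ T₂
  Triple-≡ refl refl refl = refl

  fromTriple∘toTriple : ∀ t → fromTriple (toTriple t) ≡ t
  fromTriple∘toTriple (mkRPP+1 τ p* two ones _) = RPP+1-≡ (adjoinAt-minima τ p* two′ ones′ _) refl
    where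
    two′ : ∣ lookup τ p* ∣ ≡ 2
    two′ = recompute (_ ℕ.≟ _) two
    ones′ : ∀ q → q ≢ p* → ∣ lookup τ q ∣ ≡ 1
    ones′ q q≢p* = recompute (_ ℕ.≟ _) (ones q q≢p*)

  toTriple∘fromTriple : ∀ T → toTriple (fromTriple T) ≡ T
  toTriple∘fromTriple (mkTriple π _ i p p-maximal) =
    Triple-≡ (minima-adjoinAt π i p πp≤i) (reduce≥-≡suc (maxSub-adjoinAt π i p πp≤i)) refl
    where
    πp≤i : toℕ (lookup π p) ≤ toℕ i
    πp≤i = recompute (_ ≤? _) (proj₁ p-maximal)

lemma4p1 : (P : FinPoset) (m : ℕ) → 1 ≤ m →
    Σ (RPP+1 P m → Triple P m) λ f →
      (∀ t → Triple.π (f t) ≡ tabulate (λ q → minSub (lookup (RPP+1.τ t) q))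
           × toℕ (Triple.i (f t)) ≡ toℕ (RPP+1.i* t) ∸ 1
           × Triple.p (f t) ≡ RPP+1.p* t)
      × Bijective _≡_ _≡_ f
lemma4p1 P m _ = toTriple , (λ t → refl , toℕ-reduce≥ (RPP+1.i* t) _ , refl) , bijective
  where
  open Correspondence P m
  bijective : Bijective _≡_ _≡_ toTriple
  bijective = inverseᵇ⇒bijective
    ( strictlyInverseˡ⇒inverseˡ {f⁻¹ = fromTriple} toTriple toTriple∘fromTriple
    , strictlyInverseʳ⇒inverseʳ {f⁻¹ = fromTriple} toTriple fromTriple∘toTriple )
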